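{- Let $G$ be a finite cyclic group and let $e,g,h\in G$ be three distinct elements such that $e$ and $g$ are generating elements of $G$ ($h$ arbitrary). Set $G_0=\{e,g,h\}$ and $d=|G|/\operatorname{ord}(h)$. If $\sigma_e(h)\neq d$ and $\sigma_g(h)\neq d$, then $\min\Delta(G_0)<(2|G|^2)^{1/3}$.
   Context: For a generating element $e$ of a finite cyclic group $G$ and $h\in G$, $\sigma_e(h)$ is the unique $a\in[1,|G|]$ with $h=ae$. For $G_0\subseteq G$: $\mathcal B(G_0)$ is the monoid of zero-sum sequences over $G_0$ (finite unordered lists of elements of $G_0$ with sum $0$), whose atoms are the minimal zero-sum sequences; $\mathsf L(B)$ is the set of lengths of factorizations of $B$ into minimal zero-sum sequences; for $L=\{\ell_1<\dots<\ell_k\}$, $\Delta(L)=\{\ell_{i+1}-\ell_i\}$; $\Delta(G_0)=\bigcup_B\Delta(\mathsf L(B))$; $\min\Delta(G_0)$ is its minimum, with $\min\emptyset=0$. -}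

module Defs where

open import Data.Nat using (ℕ; zero; suc; _+_; _*_; _∸_; _≤_; _<_)
open import Data.Nat.Divisibility using (_∣_)
open import Data.Vec using (Vec; []; _∷_; zipWith; replicate; foldr)
import Data.Vec as V
open import Data.Vec.Relation.Binary.Pointwise.Inductive using (Pointwise)
open import Data.List using (List; length)
import Data.List as L
open import Data.List.Relation.Unary.All using (All)
open import Data.Product using (Σ; ∃; ∃-syntax; _×_; _,_)
open import Data.Sum using (_⊎_)
open import Relation.Nullary using (¬_)
open import Relation.Binary.PropositionalEquality using (_≡_)

-- The finite cyclic group G of order n is modelled as ℤ/nℤ, elements
-- being represented by naturals x < n.

Cong : ℕ → ℕ → ℕ → Set
Cong n x y = ∃[ k ] ∃[ l ] x + k * n ≡ y + l * n

Generates : ℕ → ℕ → Set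
Generates n e = ∀ x → x < n → ∃[ a ] Cong n (a * e) x

IsOrder : ℕ → ℕ → ℕ → Set
IsOrder n h o = 0 < o × n ∣ o * h × (∀ j → 0 < j → n ∣ j * h → o ≤ j)

IsSigma : ℕ → ℕ → ℕ → ℕ → Set
IsSigma n e h a = 1 ≤ a × a ≤ n × Cong n (a * e) h

-- Sequences over G₀ = {g₀,…,g_{k-1}} (pairwise distinct elements, given as a
-- vector) are represented by their multiplicity vectors.
Seq : ℕ → Set
Seq k = Vec ℕ k

weight : ∀ {k} → Vec ℕ k → Seq k → ℕ
weight G₀ S = foldr (λ _ → ℕ) _+_ 0 (zipWith _*_ S G₀)

seqLength : ∀ {k} → Seq k → ℕ
seqLength S = foldr (λ _ → ℕ) _+_ 0 S

_≼_ : ∀ {k} → Seq k → Seq k → Set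
T ≼ S = Pointwise _≤_ T S

ZeroSum : ℕ → ∀ {k} → Vec ℕ k → Seq k → Set
ZeroSum n G₀ S = n ∣ weight G₀ S

Atom : ℕ → ∀ {k} → Vec ℕ k → Seq k → Set
Atom n G₀ A =
  ZeroSum n G₀ A × 0 < seqLength A ×
  (∀ T → T ≼ A → ZeroSum n G₀ T → 0 < seqLength T → T ≡ A)

prodSeq : ∀ {k} → List (Seq k) → Seq k
prodSeq {k} = L.foldr (zipWith _+_) (replicate k 0)

InL : ℕ → ∀ {k} → Vec ℕ k → Seq k → ℕ → Set
InL n {k} G₀ B ℓ =
  ∃[ As ] (All (Atom n G₀) As × length As ≡ ℓ × prodSeq As ≡ B)

InΔL : ℕ → ∀ {k} → Vec ℕ k → Seq k → ℕ → Set
InΔL n G₀ B δ =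
  ∃[ ℓ ] ∃[ ℓ′ ] (InL n G₀ B ℓ × InL n G₀ B ℓ′ × ℓ < ℓ′ ×
    (∀ m → ℓ < m → m < ℓ′ → ¬ InL n G₀ B m) × δ ≡ ℓ′ ∸ ℓ)

InΔ : ℕ → ∀ {k} → Vec ℕ k → ℕ → Set
InΔ n G₀ δ = ∃[ B ] (ZeroSum n G₀ B × InΔL n G₀ B δ)

-- m = min Δ(G₀), with the convention min ∅ = 0
IsMinΔ : ℕ → ∀ {k} → Vec ℕ k → ℕ → Set
IsMinΔ n G₀ m =
  (m ≡ 0 × (∀ δ → ¬ InΔ n G₀ δ)) ⊎
  (InΔ n G₀ m × (∀ δ → InΔ n G₀ δ → m ≤ δ))

module Submission where

-- The case min Δ = 0 is trivial; otherwise the proof runs as follows.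
--  1. m = min Δ(G₀) divides every difference ℓ′ − ℓ of two lengths of one B ∈ 𝓑(G₀): otherwise
--     combining a q-th power of a factorization realising m with B yields a gap smaller than m.
--  2. Pair lemma. Let u generate G, v = s u with s = σ_u(v) ∤ n, n = Q s + r (Q ≥ 1, 0 < r < s)
--     and k the least integer with s ≤ k r.  For p = k (Q − 1) + 1 the zero-sum sequence
--     (u^(n−s) v)^(p+k) equals u^(kr−s) v^(kQ+1) · (u^n)^p, and all three factors are atoms, so
--     it has factorizations of lengths p + k and p + 1.  By 1, m ∣ k − 1, whence m r < s.
--  3. The hypotheses make b = σ_e(g), c = σ_e(h) and c′ = σ_g(h) non-divisors of n, so the pair
--     lemma applies to the pairs (e,g), (e,h), (g,h); moreover c ≡ c′ b (mod n).
--  4. Writing n = Qᵢ sᵢ + rᵢ for s₁ = b, s₂ = c, s₃ = c′, the relation c ≡ c′ b gives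
--     n ∣ X + Y with X = Q₂ r₁ r₃, Y = Q₁ Q₃ r₂, so n ≤ X + Y ≤ 2XY, while m rᵢ Qᵢ < n gives
--     m³ X Y < n³.  Hence m³ n < 2 n³.

open import Defs
open import Data.Nat using (ℕ; _*_; _^_; _<_)
open import Data.Vec using (_∷_; [])
open import Relation.Binary.PropositionalEquality using (_≡_; _≢_)

open import Data.Nat using (zero; suc; _+_; _∸_; _≤_; z≤n; s≤s; z<s; _≟_;
  NonZero; >-nonZero; >-nonZero⁻¹; ≢-nonZero; ≢-nonZero⁻¹)
open import Data.Nat.Properties
open import Data.Nat.Divisibility
open import Data.Nat.DivMod using (_/_; _%_; m≡m%n+[m/n]*n; m%n<n; m/n*n≤m; m≥n⇒m/n>0;
  [m+kn]%n≡m%n; m<n⇒m%n≡m)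
open import Data.Nat.Tactic.RingSolver using (solve-∀)
open import Data.Vec using (Vec; zipWith; replicate)
open import Data.Vec.Properties using (zipWith-assoc; zipWith-identityˡ)
import Data.Vec.Relation.Binary.Pointwise.Inductive as Pointwise
open import Data.List as List using (List; _++_)
import Data.List.Properties as List
import Data.List.Relation.Unary.All as All
import Data.List.Relation.Unary.All.Properties as All
open import Data.Product using (∃-syntax; _×_; _,_; proj₁; proj₂)
open import Data.Sum using (inj₁; inj₂)
open import Data.Empty using (⊥; ⊥-elim)
open import Level using (0ℓ)
open import Relation.Nullary using (¬_; yes; no)
open import Relation.Nullary.Decidable using (¬¬-excluded-middle)
open import Relation.Binary.Bundles using (Setoid)
import Relation.Binary.Reasoning.Setoid as SetoidReasoning
open import Relation.Binary.PropositionalEquality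
  using (refl; sym; trans; cong; cong₂; subst; subst₂; module ≡-Reasoning)

Unit : ℕ → ℕ → Set
Unit n u = ∃[ t ] Cong n (t * u) 1

module Congruence (n : ℕ) where

  infix 4 _≋_
  _≋_ : ℕ → ℕ → Set
  _≋_ = Cong n

  ≋-refl : ∀ {a} → a ≋ a
  ≋-refl = 0 , 0 , refl

  ≋-sym : ∀ {a b} → a ≋ b → b ≋ a
  ≋-sym (k , l , eq) = l , k , sym eq

  ≋-trans : ∀ {a b c} → a ≋ b → b ≋ c → a ≋ c
  ≋-trans {a} {b} {c} (k₁ , l₁ , eq₁) (k₂ , l₂ , eq₂) = k₁ + k₂ , l₂ + l₁ , (begin
      a + (k₁ + k₂) * n        ≡⟨ split a k₁ k₂ n ⟩
      (a + k₁ * n) + k₂ * n    ≡⟨ cong (_+ k₂ * n) eq₁ ⟩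
      (b + l₁ * n) + k₂ * n    ≡⟨ swap b l₁ k₂ n ⟩
      (b + k₂ * n) + l₁ * n    ≡⟨ cong (_+ l₁ * n) eq₂ ⟩
      (c + l₂ * n) + l₁ * n    ≡⟨ sym (split c l₂ l₁ n) ⟩
      c + (l₂ + l₁) * n        ∎)
    where
    open ≡-Reasoning
    split : ∀ a k l n → a + (k + l) * n ≡ (a + k * n) + l * n
    split = solve-∀
    swap : ∀ a k l n → (a + k * n) + l * n ≡ (a + l * n) + k * n
    swap = solve-∀

  ≋-setoid : Setoid 0ℓ 0ℓ
  ≋-setoid = record
    { Carrier = ℕ ; _≈_ = _≋_
    ; isEquivalence = record { refl = ≋-refl ; sym = ≋-sym ; trans = ≋-trans } }

  module ≋-Reasoning = SetoidReasoning ≋-setoid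

  ≋-+ : ∀ {a b c d} → a ≋ b → c ≋ d → a + c ≋ b + d
  ≋-+ {a} {b} {c} {d} (k₁ , l₁ , eq₁) (k₂ , l₂ , eq₂) = k₁ + k₂ , l₁ + l₂ , (begin
      a + c + (k₁ + k₂) * n          ≡⟨ regroup a c k₁ k₂ n ⟩
      (a + k₁ * n) + (c + k₂ * n)    ≡⟨ cong₂ _+_ eq₁ eq₂ ⟩
      (b + l₁ * n) + (d + l₂ * n)    ≡⟨ sym (regroup b d l₁ l₂ n) ⟩
      b + d + (l₁ + l₂) * n          ∎)
    where
    open ≡-Reasoning
    regroup : ∀ a c k l n → a + c + (k + l) * n ≡ (a + k * n) + (c + l * n)
    regroup = solve-∀

  ≋-*ˡ : ∀ c {a b} → a ≋ b → c * a ≋ c * b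
  ≋-*ˡ c {a} {b} (k , l , eq) = c * k , c * l , (begin
      c * a + c * k * n    ≡⟨ factor c a k n ⟩
      c * (a + k * n)      ≡⟨ cong (c *_) eq ⟩
      c * (b + l * n)      ≡⟨ sym (factor c b l n) ⟩
      c * b + c * l * n    ∎)
    where
    open ≡-Reasoning
    factor : ∀ c a k n → c * a + c * k * n ≡ c * (a + k * n)
    factor = solve-∀

  ≋-*ʳ : ∀ c {a b} → a ≋ b → a * c ≋ b * c
  ≋-*ʳ c {a} {b} a≋b = subst₂ _≋_ (*-comm c a) (*-comm c b) (≋-*ˡ c a≋b)

  ∣⇒≋0 : ∀ {a} → n ∣ a → a ≋ 0
  ∣⇒≋0 {a} (divides q eq) = 0 , q , trans (+-identityʳ a) eq

  ≋0⇒∣ : ∀ {a} → a ≋ 0 → n ∣ a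
  ≋0⇒∣ {a} (k , l , eq) =
    ∣m+n∣m⇒∣n (subst (n ∣_) (trans (sym eq) (+-comm a (k * n))) (n∣m*n l)) (n∣m*n k)

  ≋⇒≡ : ∀ {a b} → a < n → b < n → a ≋ b → a ≡ b
  ≋⇒≡ {a} {b} a<n b<n (k , l , eq) = begin
      a                  ≡⟨ sym (m<n⇒m%n≡m a<n) ⟩
      a % n              ≡⟨ sym ([m+kn]%n≡m%n a k n) ⟩
      (a + k * n) % n    ≡⟨ cong (_% n) eq ⟩
      (b + l * n) % n    ≡⟨ [m+kn]%n≡m%n b l n ⟩
      b % n              ≡⟨ m<n⇒m%n≡m b<n ⟩
      b                  ∎
    where
    open ≡-Reasoning
    instance
      n≢0 : NonZero n
      n≢0 = >-nonZero (≤-trans (s≤s z≤n) a<n)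

  cancel-unit : ∀ {u x y} → Unit n u → x * u ≋ y * u → x ≋ y
  cancel-unit {u} {x} {y} (t , tu≋1) xu≋yu = begin
      x              ≡⟨ sym (*-identityʳ x) ⟩
      x * 1          ≈⟨ ≋-*ˡ x (≋-sym tu≋1) ⟩
      x * (t * u)    ≡⟨ exchange x t u ⟩
      t * (x * u)    ≈⟨ ≋-*ˡ t xu≋yu ⟩
      t * (y * u)    ≡⟨ sym (exchange y t u) ⟩
      y * (t * u)    ≈⟨ ≋-*ˡ y tu≋1 ⟩
      y * 1          ≡⟨ *-identityʳ y ⟩
      y              ∎
    where
    open ≋-Reasoning
    exchange : ∀ a b c → a * (b * c) ≡ b * (a * c)
    exchange = solve-∀

  σ-of-generator-is-unit : ∀ {e g b a} → Unit n e → b * e ≋ g → a * g ≋ e → a * b ≋ 1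
  σ-of-generator-is-unit {e} {g} {b} {a} e-unit be≋g ag≋e = cancel-unit {e} {a * b} {1} e-unit (begin
      a * b * e     ≡⟨ *-assoc a b e ⟩
      a * (b * e)   ≈⟨ ≋-*ˡ a be≋g ⟩
      a * g         ≈⟨ ag≋e ⟩
      e             ≡⟨ sym (*-identityˡ e) ⟩
      1 * e         ∎)
    where open ≋-Reasoning

  unit∣n⇒∣1 : ∀ {a b} → a * b ≋ 1 → b ∣ n → b ∣ 1
  unit∣n⇒∣1 {a} {b} (K , L , ab+Kn≡1+Ln) b∣n =
    ∣m+n∣m⇒∣n (subst (b ∣_) (trans ab+Kn≡1+Ln (+-comm 1 (L * n)))
                (∣m∣n⇒∣m+n (n∣m*n a) (∣n⇒∣m*n K b∣n)))
              (∣n⇒∣m*n L b∣n)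

  σ-relation : ∀ {e g h b c c′} → Unit n e →
    IsSigma n e g b → IsSigma n e h c → IsSigma n g h c′ → c ≋ c′ * b
  σ-relation {e} {g} {h} {b} {c} {c′} e-unit (_ , _ , be≋g) (_ , _ , ce≋h) (_ , _ , c′g≋h) =
    cancel-unit {e} {c} {c′ * b} e-unit (begin
      c * e          ≈⟨ ce≋h ⟩
      h              ≈⟨ ≋-sym c′g≋h ⟩
      c′ * g         ≈⟨ ≋-*ˡ c′ (≋-sym be≋g) ⟩
      c′ * (b * e)   ≡⟨ sym (*-assoc c′ b e) ⟩
      c′ * b * e     ∎)
    where open ≋-Reasoning

infixl 6 _⊕_
_⊕_ : ∀ {k} → Seq k → Seq k → Seq k
_⊕_ = zipWith _+_

prodSeq-++ : ∀ {k} (As Bs : List (Seq k)) → prodSeq (As ++ Bs) ≡ prodSeq As ⊕ prodSeq Bs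
prodSeq-++ List.[] Bs = sym (zipWith-identityˡ +-identityˡ (prodSeq Bs))
prodSeq-++ (A List.∷ As) Bs =
  trans (cong (A ⊕_) (prodSeq-++ As Bs)) (sym (zipWith-assoc +-assoc A (prodSeq As) (prodSeq Bs)))

weight-⊕ : ∀ {k} (G₀ A B : Vec ℕ k) → weight G₀ (A ⊕ B) ≡ weight G₀ A + weight G₀ B
weight-⊕ [] [] [] = refl
weight-⊕ (g ∷ G₀) (a ∷ A) (b ∷ B) rewrite weight-⊕ G₀ A B = regroup a b g (weight G₀ A) (weight G₀ B)
  where
  regroup : ∀ a b g x y → (a + b) * g + (x + y) ≡ a * g + x + (b * g + y)
  regroup = solve-∀

weight-empty : ∀ {k} (G₀ : Vec ℕ k) → weight G₀ (replicate k 0) ≡ 0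
weight-empty [] = refl
weight-empty (g ∷ G₀) = weight-empty G₀

power : ∀ {k} → ℕ → Seq k → Seq k
power q B = prodSeq (List.replicate q B)

module Factorizations (n : ℕ) {k : ℕ} (G₀ : Vec ℕ k) where

  product-zeroSum : ∀ As → All.All (Atom n G₀) As → ZeroSum n G₀ (prodSeq As)
  product-zeroSum List.[] All.[] = divides 0 (weight-empty G₀)
  product-zeroSum (A List.∷ As) (atomA All.∷ atoms) rewrite weight-⊕ G₀ A (prodSeq As) =
    ∣m∣n⇒∣m+n (proj₁ atomA) (product-zeroSum As atoms)

  InL⇒zeroSum : ∀ {B ℓ} → InL n G₀ B ℓ → ZeroSum n G₀ B
  InL⇒zeroSum (As , atoms , _ , refl) = product-zeroSum As atoms

  InL-⊕ : ∀ {B B′ ℓ ℓ′} → InL n G₀ B ℓ → InL n G₀ B′ ℓ′ → InL n G₀ (B ⊕ B′) (ℓ + ℓ′)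
  InL-⊕ (As , atoms , refl , refl) (Bs , atoms′ , refl , refl) =
    As ++ Bs , All.++⁺ atoms atoms′ , List.length-++ As , prodSeq-++ As Bs

  InL-power : ∀ q {B ℓ} → InL n G₀ B ℓ → InL n G₀ (power q B) (q * ℓ)
  InL-power zero _ = List.[] , All.[] , refl , refl
  InL-power (suc q) f = InL-⊕ f (InL-power q f)

  atom-power : ∀ q {A} → Atom n G₀ A → InL n G₀ (power q A) q
  atom-power q {A} atomA = List.replicate q A , All.replicate⁺ q atomA , List.length-replicate q , refl

  DividesLengthGaps : ℕ → Set
  DividesLengthGaps m = ∀ {B ℓ ℓ′} → InL n G₀ B ℓ → InL n G₀ B ℓ′ → ℓ < ℓ′ → m ∣ ℓ′ ∸ ℓ

  module _ {m : ℕ} (m≤Δ : ∀ δ → InΔ n G₀ δ → m ≤ δ) where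

    -- Two lengths of one B never differ by less than m = min Δ(G₀): if no length lies strictly
    -- between them their difference belongs to Δ(G₀), otherwise recurse on a closer pair.
    -- (The fuel bounds ℓ′; the case split is classical, which is fine as the goal is ⊥.)
    no-short-gap : ∀ fuel {B ℓ ℓ′} → ℓ′ ≤ fuel →
      InL n G₀ B ℓ → InL n G₀ B ℓ′ → ℓ < ℓ′ → ℓ′ ∸ ℓ < m → ⊥
    no-short-gap zero z≤n _ _ () _
    no-short-gap (suc fuel) {B} {ℓ} {ℓ′} ℓ′≤fuel fℓ fℓ′ ℓ<ℓ′ short =
      ¬¬-excluded-middle {A = ∃[ z ] (ℓ < z × z < ℓ′ × InL n G₀ B z)} λ where
        (yes (z , ℓ<z , z<ℓ′ , fz)) →
          no-short-gap fuel (≤-pred (≤-trans z<ℓ′ ℓ′≤fuel)) fℓ fz ℓ<z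
            (≤-<-trans (∸-monoˡ-≤ ℓ (<⇒≤ z<ℓ′)) short)
        (no nothing-between) →
          <⇒≱ short (m≤Δ (ℓ′ ∸ ℓ) (B , InL⇒zeroSum fℓ , ℓ , ℓ′ , fℓ , fℓ′ , ℓ<ℓ′ ,
            (λ z ℓ<z z<ℓ′ fz → nothing-between (z , ℓ<z , z<ℓ′ , fz)) , refl))

    -- Hence m = min Δ(G₀) divides every length difference: if ℓ′ − ℓ = q m + ρ with 0 < ρ < m
    -- and ℓ₁, ℓ₁ + m are lengths of B₁, then B₁^q B has the lengths q(ℓ₁ + m) + ℓ and q ℓ₁ + ℓ′,
    -- which differ by ρ.
    minΔ∣gaps : InΔ n G₀ m → DividesLengthGaps m
    minΔ∣gaps (B₁ , _ , ℓ₁ , ℓ₁′ , fℓ₁ , fℓ₁′ , ℓ₁<ℓ₁′ , _ , m≡) {B} {ℓ} {ℓ′} fℓ fℓ′ ℓ<ℓ′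
      with m ∣? (ℓ′ ∸ ℓ)
    ... | yes m∣D = m∣D
    ... | no m∤D = ⊥-elim (no-short-gap y ≤-refl
                     (InL-⊕ (InL-power q fℓ₁′) fℓ) (InL-⊕ (InL-power q fℓ₁) fℓ′)
                     (subst (x <_) (sym y≡x+ρ) (m<m+n x ρ>0))
                     (subst (_< m) (sym (trans (cong (_∸ x) y≡x+ρ) (m+n∸m≡n x ρ))) (m%n<n D m)))
      where
      instance
        m≢0 : NonZero m
        m≢0 = >-nonZero (subst (0 <_) (sym m≡) (m<n⇒0<n∸m ℓ₁<ℓ₁′))
      D q ρ x y : ℕ
      D = ℓ′ ∸ ℓ
      q = D / m
      ρ = D % m
      ρ>0 : 0 < ρ
      ρ>0 = n≢0⇒n>0 (λ ρ≡0 → m∤D (m%n≡0⇒n∣m D m ρ≡0))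
      x = q * ℓ₁′ + ℓ
      y = q * ℓ₁ + ℓ′
      y≡x+ρ : y ≡ x + ρ
      y≡x+ρ = begin
        q * ℓ₁ + ℓ′                 ≡⟨ cong (q * ℓ₁ +_) (sym (m+[n∸m]≡n (<⇒≤ ℓ<ℓ′))) ⟩
        q * ℓ₁ + (ℓ + D)            ≡⟨ cong (λ j → q * ℓ₁ + (ℓ + j)) (m≡m%n+[m/n]*n D m) ⟩
        q * ℓ₁ + (ℓ + (ρ + q * m))  ≡⟨ regroup q ℓ₁ ℓ ρ m ⟩
        q * (ℓ₁ + m) + ℓ + ρ        ≡⟨ cong (λ j → q * j + ℓ + ρ) ℓ₁+m≡ℓ₁′ ⟩
        x + ρ                       ∎
        where
        open ≡-Reasoning
        regroup : ∀ q l₁ l r m → q * l₁ + (l + (r + q * m)) ≡ q * (l₁ + m) + l + r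
        regroup = solve-∀
        ℓ₁+m≡ℓ₁′ : ℓ₁ + m ≡ ℓ₁′
        ℓ₁+m≡ℓ₁′ = trans (cong (ℓ₁ +_) m≡) (m+[n∸m]≡n (<⇒≤ ℓ₁<ℓ₁′))

-- A pair {u, v} of entries of G₀: P x y is the sequence u^x v^y over G₀, and every
-- subsequence of u^x v^y is again of this form.
record PairEmbedding {k : ℕ} (G₀ : Vec ℕ k) (u v : ℕ) : Set where
  field
    P   : ℕ → ℕ → Seq k
    wt  : ∀ x y → weight G₀ (P x y) ≡ x * u + y * v
    len : ∀ x y → seqLength (P x y) ≡ x + y
    sub : ∀ {T x y} → T ≼ P x y → ∃[ x′ ] ∃[ y′ ] (T ≡ P x′ y′ × x′ ≤ x × y′ ≤ y)
    add : ∀ x y x′ y′ → P x y ⊕ P x′ y′ ≡ P (x + x′) (y + y′)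
    empty : P 0 0 ≡ replicate k 0

  power-P : ∀ c x y → power c (P x y) ≡ P (c * x) (c * y)
  power-P zero x y = sym empty
  power-P (suc c) x y = trans (cong (P x y ⊕_) (power-P c x y)) (add x y (c * x) (c * y))

module Pairs (e g h : ℕ) where
  open Pointwise using (_∷_; [])

  pair-eg : PairEmbedding (e ∷ g ∷ h ∷ []) e g
  pair-eg = record
    { P = λ x y → x ∷ y ∷ 0 ∷ []
    ; wt = λ x y → cong (x * e +_) (+-identityʳ (y * g))
    ; len = λ x y → cong (x +_) (+-identityʳ y)
    ; sub = λ { {a ∷ b ∷ _ ∷ []} (a≤ ∷ b≤ ∷ z≤n ∷ []) → a , b , refl , a≤ , b≤ }
    ; add = λ _ _ _ _ → refl
    ; empty = refl }

  pair-eh : PairEmbedding (e ∷ g ∷ h ∷ []) e h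
  pair-eh = record
    { P = λ x y → x ∷ 0 ∷ y ∷ []
    ; wt = λ x y → cong (x * e +_) (+-identityʳ (y * h))
    ; len = λ x y → cong (x +_) (+-identityʳ y)
    ; sub = λ { {a ∷ _ ∷ b ∷ []} (a≤ ∷ z≤n ∷ b≤ ∷ []) → a , b , refl , a≤ , b≤ }
    ; add = λ _ _ _ _ → refl
    ; empty = refl }

  pair-gh : PairEmbedding (e ∷ g ∷ h ∷ []) g h
  pair-gh = record
    { P = λ x y → 0 ∷ x ∷ y ∷ []
    ; wt = λ x y → cong (x * g +_) (+-identityʳ (y * h))
    ; len = λ x y → cong (x +_) (+-identityʳ y)
    ; sub = λ { {_ ∷ a ∷ b ∷ []} (z≤n ∷ a≤ ∷ b≤ ∷ []) → a , b , refl , a≤ , b≤ }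
    ; add = λ _ _ _ _ → refl
    ; empty = refl }

record ProperDivision (n s : ℕ) : Set where
  field
    q₀ rem : ℕ
    n≡    : n ≡ suc q₀ * s + rem
    rem>0 : 0 < rem
    rem<s : rem < s

  quot : ℕ
  quot = suc q₀

  quot>0 : 0 < quot
  quot>0 = z<s

properDivision : ∀ {n s} → 0 < s → s ≤ n → ¬ s ∣ n → ProperDivision n s
properDivision {n} {s} s>0 s≤n s∤n = record
  { q₀ = n / s ∸ 1 ; rem = n % s
  ; n≡ = trans (m≡m%n+[m/n]*n n s)
      (trans (+-comm (n % s) _) (cong (λ Q → Q * s + n % s) (sym (m+[n∸m]≡n (m≥n⇒m/n>0 s≤n)))))
  ; rem>0 = n≢0⇒n>0 (λ r≡0 → s∤n (m%n≡0⇒n∣m n s r≡0))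
  ; rem<s = m%n<n n s }
  where
  instance
    s≢0 : NonZero s
    s≢0 = >-nonZero s>0

below-multiple : ∀ s r .{{_ : NonZero r}} → 0 < s → ∃[ k′ ] (k′ * r < s × s ≤ suc k′ * r)
below-multiple (suc s₀) r _ = s₀ / r , s≤s (m/n*n≤m s₀ r) , (begin
    suc s₀                    ≡⟨ cong suc (m≡m%n+[m/n]*n s₀ r) ⟩
    suc (s₀ % r + s₀ / r * r) ≤⟨ +-monoˡ-≤ (s₀ / r * r) (m%n<n s₀ r) ⟩
    r + s₀ / r * r            ∎)
  where open ≤-Reasoning

-- Arithmetic core of the minimality of W = u^w v^(kQ+1) with k = k′ + 1: if n = Q s + r,
-- k′ r < s and w + s = k r (so w < r), the only nonzero solution of x′ + y′ s ≡ 0 (mod n)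
-- with x′ ≤ w and y′ ≤ kQ + 1 is (w, kQ + 1).
module W-Minimality {n s r Q k′ w : ℕ} .{{_ : NonZero Q}}
       (n≡ : n ≡ Q * s + r) (k′r<s : k′ * r < s) (w+s≡kr : w + s ≡ suc k′ * r) where

  k Y : ℕ
  k = suc k′
  Y = k * Q + 1

  w<r : w < r
  w<r = +-cancelʳ-< s w r (subst (_< r + s) (sym w+s≡kr) (+-monoʳ-< r k′r<s))

  expand : ∀ M → M * n ≡ M * Q * s + M * r
  expand M = trans (cong (M *_) n≡) (distribute M Q s r)
    where
    distribute : ∀ M Q s r → M * (Q * s + r) ≡ M * Q * s + M * r
    distribute = solve-∀

  W-weight : w + Y * s ≡ k * n
  W-weight = begin
    w + (k * Q + 1) * s      ≡⟨ regroup w s k Q ⟩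
    (w + s) + k * (Q * s)    ≡⟨ cong (_+ k * (Q * s)) w+s≡kr ⟩
    k * r + k * (Q * s)      ≡⟨ factor k r (Q * s) ⟩
    k * (Q * s + r)          ≡⟨ cong (k *_) (sym n≡) ⟩
    k * n                    ∎
    where
    open ≡-Reasoning
    regroup : ∀ w s k Q → w + (k * Q + 1) * s ≡ (w + s) + k * (Q * s)
    regroup = solve-∀
    factor : ∀ k r a → k * r + k * a ≡ k * (a + r)
    factor = solve-∀

  -- if y′ ≤ M Q then x′ ≥ M r, which is impossible for 0 < M (as x′ ≤ w < r) and for M = 0
  low-case : ∀ {x′ y′} M → x′ ≤ w → x′ + y′ * s ≡ M * n → 0 < x′ + y′ → y′ ≤ M * Q → ⊥
  low-case zero _ eq pos z≤n = <-irrefl refl (subst (0 <_) eq pos)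
  low-case {x′} {y′} M@(suc M′) x′≤w eq _ y′≤MQ =
    <⇒≱ w<r (≤-trans (m≤m+n r (M′ * r)) (≤-trans Mr≤x′ x′≤w))
    where
    open ≤-Reasoning
    Mr≤x′ : M * r ≤ x′
    Mr≤x′ = +-cancelˡ-≤ (M * Q * s) (M * r) x′ (begin
      M * Q * s + M * r   ≡⟨ sym (expand M) ⟩
      M * n               ≡⟨ sym eq ⟩
      x′ + y′ * s         ≤⟨ +-monoʳ-≤ x′ (*-monoˡ-≤ s y′≤MQ) ⟩
      x′ + M * Q * s      ≡⟨ +-comm x′ (M * Q * s) ⟩
      M * Q * s + x′      ∎)

  -- if y′ > M Q then M r ≥ s > k′ r forces M > k′, while y′ ≤ kQ + 1 forces M ≤ k;
  -- so M = k, and then y′ = Y and x′ = w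
  high-case : ∀ {x′ y′} M → x′ + y′ * s ≡ M * n → y′ ≤ Y → M * Q < y′ → x′ ≡ w × y′ ≡ Y
  high-case {x′} {y′} M eq y′≤Y MQ<y′ = x′≡w , y′≡Y
    where
    s≤Mr : s ≤ M * r
    s≤Mr = +-cancelˡ-≤ (M * Q * s) s (M * r) (begin
      M * Q * s + s       ≡⟨ +-comm (M * Q * s) s ⟩
      suc (M * Q) * s     ≤⟨ *-monoˡ-≤ s MQ<y′ ⟩
      y′ * s              ≤⟨ m≤n+m (y′ * s) x′ ⟩
      x′ + y′ * s         ≡⟨ eq ⟩
      M * n               ≡⟨ expand M ⟩
      M * Q * s + M * r   ∎)
      where open ≤-Reasoning
    MQ≤kQ : M * Q ≤ k * Q
    MQ≤kQ = ≤-pred (≤-trans MQ<y′ (≤-trans y′≤Y (≤-reflexive (+-comm (k * Q) 1))))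
    M≡k : M ≡ k
    M≡k = ≤-antisym (*-cancelʳ-≤ M k Q MQ≤kQ) (*-cancelʳ-< r k′ M (<-≤-trans k′r<s s≤Mr))
    y′≡Y : y′ ≡ Y
    y′≡Y = ≤-antisym y′≤Y
      (subst (_≤ y′) (trans (cong (λ j → suc (j * Q)) M≡k) (+-comm 1 (k * Q))) MQ<y′)
    x′≡w : x′ ≡ w
    x′≡w = +-cancelʳ-≡ (Y * s) x′ w (begin
      x′ + Y * s     ≡⟨ cong (λ j → x′ + j * s) (sym y′≡Y) ⟩
      x′ + y′ * s    ≡⟨ eq ⟩
      M * n          ≡⟨ cong (_* n) M≡k ⟩
      k * n          ≡⟨ sym W-weight ⟩
      w + Y * s      ∎)
      where open ≡-Reasoning

  minimal : ∀ {x′ y′ M} → x′ ≤ w → y′ ≤ Y → x′ + y′ * s ≡ M * n → 0 < x′ + y′ → x′ ≡ w × y′ ≡ Y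
  minimal {y′ = y′} {M} x′≤w y′≤Y eq pos with ≤-<-connex y′ (M * Q)
  ... | inj₁ y′≤MQ = ⊥-elim (low-case M x′≤w eq pos y′≤MQ)
  ... | inj₂ MQ<y′ = high-case M eq y′≤Y MQ<y′

module PairLemma (n : ℕ) {size : ℕ} {G₀ : Vec ℕ size} {u v : ℕ} (E : PairEmbedding G₀ u v)
                 (u-unit : Unit n u) {s : ℕ} (su≋v : Cong n (s * u) v) where
  open PairEmbedding E
  open Congruence n
  open Factorizations n G₀

  factor : ∀ x y s u → x * u + y * (s * u) ≡ (x + y * s) * u
  factor = solve-∀

  zeroSum-intro : ∀ x y → n ∣ x + y * s → ZeroSum n G₀ (P x y)
  zeroSum-intro x y n∣ = subst (n ∣_) (sym (wt x y)) (≋0⇒∣ (begin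
      x * u + y * v         ≈⟨ ≋-+ (≋-refl {x * u}) (≋-*ˡ y (≋-sym su≋v)) ⟩
      x * u + y * (s * u)   ≡⟨ factor x y s u ⟩
      (x + y * s) * u       ≈⟨ ≋-*ʳ u (∣⇒≋0 n∣) ⟩
      0                     ∎))
    where open ≋-Reasoning

  zeroSum-elim : ∀ x y → ZeroSum n G₀ (P x y) → n ∣ x + y * s
  zeroSum-elim x y zs = ≋0⇒∣ (cancel-unit {u} {x + y * s} {0} u-unit (begin
      (x + y * s) * u       ≡⟨ sym (factor x y s u) ⟩
      x * u + y * (s * u)   ≈⟨ ≋-+ (≋-refl {x * u}) (≋-*ˡ y su≋v) ⟩
      x * u + y * v         ≡⟨ sym (wt x y) ⟩
      weight G₀ (P x y)     ≈⟨ ∣⇒≋0 zs ⟩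
      0                     ∎))
    where open ≋-Reasoning

  Minimal : ℕ → ℕ → Set
  Minimal x y = ∀ x′ y′ → x′ ≤ x → y′ ≤ y → n ∣ x′ + y′ * s → 0 < x′ + y′ → x′ ≡ x × y′ ≡ y

  atom-intro : ∀ x y → n ∣ x + y * s → 0 < x + y → Minimal x y → Atom n G₀ (P x y)
  atom-intro x y n∣ pos minimal = zeroSum-intro x y n∣ , subst (0 <_) (sym (len x y)) pos , only-itself
    where
    only-itself : ∀ T → T ≼ P x y → ZeroSum n G₀ T → 0 < seqLength T → T ≡ P x y
    only-itself T T≼ zsT posT = coordinates-equal (sub T≼)
      where
      coordinates-equal : ∃[ x′ ] ∃[ y′ ] (T ≡ P x′ y′ × x′ ≤ x × y′ ≤ y) → T ≡ P x y
      coordinates-equal (x′ , y′ , T≡P , x′≤x , y′≤y) = trans T≡P (cong₂ P (proj₁ same) (proj₂ same))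
        where
        same : x′ ≡ x × y′ ≡ y
        same = minimal x′ y′ x′≤x y′≤y (zeroSum-elim x′ y′ (subst (ZeroSum n G₀) T≡P zsT))
                 (subst (0 <_) (trans (cong seqLength T≡P) (len x′ y′)) posT)

  -- With n = Q s + r and k′ r < s ≤ (k′ + 1) r: the sequence (u^(n−s) v)^(p+k) equals
  -- u^(kr−s) v^(kQ+1) · (u^n)^p, a product of atoms of lengths p + k and p + 1.
  module Witness {q₀ r : ℕ} (n≡ : n ≡ suc q₀ * s + r) (r<s : r < s)
                 {k′ : ℕ} (k′r<s : k′ * r < s) (s≤kr : s ≤ suc k′ * r) where

    Q w a p : ℕ
    Q = suc q₀
    w = suc k′ * r ∸ s
    a = n ∸ s

    open W-Minimality {n} {s} {r} {Q} {k′} {w} n≡ k′r<s (m∸n+n≡m s≤kr)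

    p = k * q₀ + 1

    s≤n : s ≤ n
    s≤n = subst (s ≤_) (sym n≡) (≤-trans (m≤m+n s (q₀ * s)) (m≤m+n (Q * s) r))

    a+s≡n : a + s ≡ n
    a+s≡n = m∸n+n≡m s≤n

    s>0 : 0 < s
    s>0 = ≤-<-trans z≤n r<s

    a<n : a < n
    a<n = subst (a <_) a+s≡n (m<m+n a s>0)

    n≤ : ∀ {x} → 0 < x → n ∣ x → n ≤ x
    n≤ pos = ∣⇒≤ {{>-nonZero pos}}

    U α W : Seq size
    U = P n 0
    α = P a 1
    W = P w Y

    atom-U : Atom n G₀ U
    atom-U = atom-intro n 0 (subst (n ∣_) (sym (+-identityʳ n)) ∣-refl)
               (subst (0 <_) (sym (+-identityʳ n)) (<-≤-trans s>0 s≤n)) minimal-U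
      where
      minimal-U : Minimal n 0
      minimal-U x′ _ x′≤n z≤n n∣ pos =
        ≤-antisym x′≤n (subst (n ≤_) (+-identityʳ x′) (n≤ pos n∣)) , refl

    atom-α : Atom n G₀ α
    atom-α = atom-intro a 1 (subst (n ∣_) (sym a+1s≡n) ∣-refl) (subst (0 <_) (+-comm 1 a) (s≤s z≤n)) minimal-α
      where
      a+1s≡n : a + 1 * s ≡ n
      a+1s≡n = trans (cong (a +_) (*-identityˡ s)) a+s≡n
      minimal-α : Minimal a 1
      minimal-α x′ zero x′≤a _ n∣ pos =
        ⊥-elim (<⇒≱ (≤-<-trans x′≤a a<n) (subst (n ≤_) (+-identityʳ x′) (n≤ pos n∣)))
      minimal-α x′ (suc zero) x′≤a _ n∣ _ =
        +-cancelʳ-≡ s x′ a (≤-antisym (+-monoˡ-≤ s x′≤a) (subst (_≤ x′ + s) (sym a+s≡n) n≤x′+s)) , refl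
        where
        n≤x′+s : n ≤ x′ + s
        n≤x′+s = n≤ (<-≤-trans s>0 (m≤n+m s x′))
                    (subst (λ j → n ∣ x′ + j) (*-identityˡ s) n∣)
      minimal-α _ (suc (suc _)) _ (s≤s ()) _ _

    atom-W : Atom n G₀ W
    atom-W = atom-intro w Y (divides k W-weight)
               (<-≤-trans (subst (0 <_) (+-comm 1 (k * Q)) (s≤s z≤n)) (m≤n+m Y w)) minimal-W
      where
      minimal-W : Minimal w Y
      minimal-W x′ y′ x′≤w y′≤Y (divides M eq) pos = minimal {M = M} x′≤w y′≤Y eq pos

    p+k≡Y : p + k ≡ Y
    p+k≡Y = regroup k q₀
      where
      regroup : ∀ k q → k * q + 1 + k ≡ k * suc q + 1
      regroup = solve-∀

    -- both products have u-multiplicity w + p n = (p + k) a and v-multiplicity kQ + 1 = p + k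
    same-sequence : W ⊕ power p U ≡ power (p + k) α
    same-sequence = begin
      P w Y ⊕ power p (P n 0)          ≡⟨ cong (P w Y ⊕_) (power-P p n 0) ⟩
      P w Y ⊕ P (p * n) (p * 0)        ≡⟨ add w Y (p * n) (p * 0) ⟩
      P (w + p * n) (Y + p * 0)        ≡⟨ cong₂ P u-count v-count ⟩
      P ((p + k) * a) ((p + k) * 1)    ≡⟨ sym (power-P (p + k) a 1) ⟩
      power (p + k) (P a 1)            ∎
      where
      open ≡-Reasoning
      swap : ∀ a b c → a + b + c ≡ a + c + b
      swap = solve-∀
      u-count : w + p * n ≡ (p + k) * a
      u-count = +-cancelʳ-≡ ((p + k) * s) (w + p * n) ((p + k) * a) (begin
        w + p * n + (p + k) * s      ≡⟨ cong (λ j → w + p * n + j * s) p+k≡Y ⟩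
        w + p * n + Y * s            ≡⟨ swap w (p * n) (Y * s) ⟩
        w + Y * s + p * n            ≡⟨ cong (_+ p * n) W-weight ⟩
        k * n + p * n                ≡⟨ sym (*-distribʳ-+ n k p) ⟩
        (k + p) * n                  ≡⟨ cong (_* n) (+-comm k p) ⟩
        (p + k) * n                  ≡⟨ cong ((p + k) *_) (sym a+s≡n) ⟩
        (p + k) * (a + s)            ≡⟨ *-distribˡ-+ (p + k) a s ⟩
        (p + k) * a + (p + k) * s    ∎)
      v-count : Y + p * 0 ≡ (p + k) * 1
      v-count = trans (cong (Y +_) (*-zeroʳ p))
                  (trans (+-identityʳ Y) (trans (sym p+k≡Y) (sym (*-identityʳ (p + k)))))

    short : InL n G₀ (power (p + k) α) (suc p)
    short = subst (λ B → InL n G₀ B (suc p)) same-sequence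
      (W List.∷ List.replicate p U , atom-W All.∷ All.replicate⁺ p atom-U ,
       cong suc (List.length-replicate p) , refl)

    long : InL n G₀ (power (p + k) α) (p + k)
    long = atom-power (p + k) atom-α

    k′>0 : 0 < k′
    k′>0 = n≢0⇒n>0 λ k′≡0 →
      <⇒≱ r<s (≤-trans (subst (λ j → s ≤ suc j * r) k′≡0 s≤kr) (≤-reflexive (+-identityʳ r)))

    short<long : suc p < p + k
    short<long = subst (suc p <_) (sym (+-suc p k′)) (s≤s (m<m+n p k′>0))

    long∸short : (p + k) ∸ suc p ≡ k′
    long∸short = trans (cong (_∸ suc p) (+-suc p k′)) (m+n∸m≡n p k′)

  -- If m divides all length gaps, then m r < s: m divides the gap k′ between the two
  -- factorizations of the witness, so m ≤ k′ and m r ≤ k′ r < s.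
  pair-lemma : ∀ {m} → DividesLengthGaps m → (D : ProperDivision n s) → m * ProperDivision.rem D < s
  pair-lemma {m} m∣gaps record { q₀ = q₀ ; rem = r ; n≡ = n≡ ; rem>0 = r>0 ; rem<s = r<s }
    with below-multiple s r {{>-nonZero r>0}} (≤-<-trans z≤n r<s)
  ... | k′ , k′r<s , s≤kr = ≤-<-trans (*-monoˡ-≤ r m≤k′) k′r<s
    where
    open Witness {q₀} {r} n≡ r<s {k′} k′r<s s≤kr
    m≤k′ : m ≤ k′
    m≤k′ = ∣⇒≤ {{>-nonZero k′>0}} (subst (m ∣_) long∸short (m∣gaps short long short<long))

module Sigma (n : ℕ) .{{_ : NonZero n}} where
  open Congruence n

  %-≋ : ∀ a → a % n ≋ a
  %-≋ a = a / n , 0 , trans (sym (m≡m%n+[m/n]*n a n)) (sym (+-identityʳ a))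

  σ-exists : ∀ {u x} → Generates n u → x < n → ∃[ σ ] IsSigma n u x σ
  σ-exists {u} {x} gen x<n with gen x x<n
  ... | a , au≋x with a % n ≟ 0
  ...   | yes a%n≡0 = n , >-nonZero⁻¹ n , ≤-refl , ≋-trans (≋-*ʳ u n≋a) au≋x
    where
    n≋a : n ≋ a
    n≋a = ≋-trans (0 , 1 , refl) (subst (_≋ a) a%n≡0 (%-≋ a))
  ...   | no a%n≢0 = a % n , n≢0⇒n>0 a%n≢0 , <⇒≤ (m%n<n a n) , ≋-trans (≋-*ʳ u (%-≋ a)) au≋x

  -- If s = σ_u(x) divides n, say n = q s, then q x ≡ 0 and q ∣ ord(x), so ord(x) = q;
  -- thus d ord(x) = n forces s = d.
  σ∤n-order : ∀ {u x s o d} → Unit n u → IsSigma n u x s → IsOrder n x o → d * o ≡ n →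
    s ≢ d → ¬ s ∣ n
  σ∤n-order {u} {x} {s} {o} {d} u-unit (_ , _ , su≋x) (o>0 , n∣ox , o-least) do≡n s≢d
            (divides q n≡qs) = s≢d (*-cancelʳ-≡ s d o {{>-nonZero o>0}} so≡do)
    where
    instance
      s≢0 : NonZero s
      s≢0 = ≢-nonZero λ s≡0 → ≢-nonZero⁻¹ n (trans n≡qs (trans (cong (q *_) s≡0) (*-zeroʳ q)))
    q>0 : 0 < q
    q>0 = n≢0⇒n>0 λ q≡0 → ≢-nonZero⁻¹ n (trans n≡qs (cong (_* s) q≡0))
    n∣qx : n ∣ q * x
    n∣qx = ≋0⇒∣ (begin
      q * x          ≈⟨ ≋-*ˡ q (≋-sym su≋x) ⟩
      q * (s * u)    ≡⟨ sym (*-assoc q s u) ⟩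
      q * s * u      ≡⟨ cong (_* u) (sym n≡qs) ⟩
      n * u          ≈⟨ ∣⇒≋0 (m∣m*n u) ⟩
      0              ∎)
      where open ≋-Reasoning
    q∣o : q ∣ o
    q∣o = *-cancelʳ-∣ s (subst (_∣ o * s) n≡qs (≋0⇒∣ (cancel-unit {u} {o * s} {0} u-unit (begin
      o * s * u      ≡⟨ *-assoc o s u ⟩
      o * (s * u)    ≈⟨ ≋-*ˡ o su≋x ⟩
      o * x          ≈⟨ ∣⇒≋0 n∣ox ⟩
      0              ∎))))
      where open ≋-Reasoning
    o≡q : o ≡ q
    o≡q = ≤-antisym (o-least q q>0 n∣qx) (∣⇒≤ {{>-nonZero o>0}} q∣o)
    so≡do : s * o ≡ d * o
    so≡do = trans (*-comm s o) (trans (cong (_* s) o≡q) (trans (sym n≡qs) (sym do≡n)))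

  -- If g generates G and b = σ_e(g) divides n, then b is a unit modulo n dividing n, so b = 1
  -- and g = e.
  σ∤n-generator : ∀ {e g b} → e < n → g < n → e ≢ g → Unit n e → Generates n g →
    IsSigma n e g b → ¬ b ∣ n
  σ∤n-generator {e} {g} {b} e<n g<n e≢g e-unit gen-g (_ , _ , be≋g) b∣n =
    e≢g (≋⇒≡ e<n g<n (begin
      e       ≡⟨ sym (*-identityˡ e) ⟩
      1 * e   ≡⟨ cong (_* e) (sym b≡1) ⟩
      b * e   ≈⟨ be≋g ⟩
      g       ∎))
    where
    open ≋-Reasoning
    b≡1 : b ≡ 1
    b≡1 with gen-g e e<n
    ... | a , ag≋e = ∣1⇒≡1 (unit∣n⇒∣1 {a} (σ-of-generator-is-unit {b = b} {a} e-unit be≋g ag≋e) b∣n)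

record PairBound (n u v m : ℕ) : Set where
  field
    σ        : ℕ
    isσ      : IsSigma n u v σ
    division : ProperDivision n σ
    bound    : m * ProperDivision.rem division < σ

pair-bound : ∀ {n size} {G₀ : Vec ℕ size} {u v m} → 1 < n → PairEmbedding G₀ u v →
  Generates n u → v < n → (∀ σ → IsSigma n u v σ → ¬ σ ∣ n) →
  Factorizations.DividesLengthGaps n G₀ m → PairBound n u v m
pair-bound {n} 1<n E gen v<n σ∤n m∣gaps
  with Sigma.σ-exists n {{>-nonZero (<-trans z<s 1<n)}} gen v<n
... | σ , isσ@(σ>0 , σ≤n , σu≋v) = record
  { σ = σ ; isσ = isσ ; division = D ; bound = PairLemma.pair-lemma n E (gen 1 1<n) σu≋v m∣gaps D }
  where
  D : ProperDivision n σ
  D = properDivision σ>0 σ≤n (σ∤n σ isσ)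

scaled-bound : ∀ {n s m} (D : ProperDivision n s) → let open ProperDivision D in
  m * rem < s → m * rem * quot < n
scaled-bound {n} {s} {m} D mr<s =
  <-≤-trans (*-monoˡ-< quot mr<s)
    (subst (_≤ n) (*-comm quot s) (subst (quot * s ≤_) (sym n≡) (m≤m+n (quot * s) rem)))
  where open ProperDivision D

-- From n = Qᵢ sᵢ + rᵢ (s₁ = b, s₂ = c, s₃ = c′) and c ≡ c′ b we get n ∣ Q₂ r₁ r₃ + Q₁ Q₃ r₂,
-- since Q₂ r₁ r₃ ≡ Q₂ (Q₁ b)(Q₃ c′) ≡ Q₁ Q₂ Q₃ c ≡ −Q₁ Q₃ r₂ (mod n).
residue-relation : ∀ {n b c c′}
  (D₁ : ProperDivision n b) (D₂ : ProperDivision n c) (D₃ : ProperDivision n c′) →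
  Cong n c (c′ * b) → let open ProperDivision in
  n ∣ quot D₂ * rem D₁ * rem D₃ + quot D₁ * quot D₃ * rem D₂
residue-relation {n} {b} {c} {c′} D₁ D₂ D₃ (K , L , c+Kn≡c′b+Ln) =
  ∣m+n∣m⇒∣n (subst (n ∣_) (trans (sym sum≡) (+-comm (X + Y) (n * P))) (m∣m*n R)) (m∣m*n P)
  where
  open ≡-Reasoning
  open ProperDivision D₁ using () renaming (quot to Q₁; rem to r₁; n≡ to n≡₁)
  open ProperDivision D₂ using () renaming (quot to Q₂; rem to r₂; n≡ to n≡₂)
  open ProperDivision D₃ using () renaming (quot to Q₃; rem to r₃; n≡ to n≡₃)
  A C Q₁₂₃ X Y P R : ℕ
  A = Q₁ * b
  C = Q₃ * c′
  Q₁₂₃ = Q₁ * Q₂ * Q₃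
  X = Q₂ * r₁ * r₃
  Y = Q₁ * Q₃ * r₂
  P = Q₂ * A + Q₂ * C + Q₁₂₃ * L
  R = Q₂ * n + Q₁ * Q₃ + Q₁₂₃ * K
  -- (n − A)(n − C) ≡ A C (mod n), written without subtraction
  residues-product : r₁ * r₃ + n * A + n * C ≡ n * n + A * C
  residues-product = begin
    r₁ * r₃ + n * A + n * C                    ≡⟨ cong₂ (λ x y → r₁ * r₃ + x * A + y * C) n≡₃ n≡₁ ⟩
    r₁ * r₃ + (C + r₃) * A + (A + r₁) * C      ≡⟨ expand r₁ r₃ A C ⟩
    (A + r₁) * (C + r₃) + A * C                ≡⟨ cong₂ (λ x y → x * y + A * C) (sym n≡₁) (sym n≡₃) ⟩
    n * n + A * C                              ∎
    where
    expand : ∀ r₁ r₃ A C → r₁ * r₃ + (C + r₃) * A + (A + r₁) * C ≡ (A + r₁) * (C + r₃) + A * C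
    expand = solve-∀
  sum≡ : X + Y + n * P ≡ n * R
  sum≡ = +-cancelʳ-≡ (Q₁₂₃ * c) _ _ (begin
    X + Y + n * P + Q₁₂₃ * c
      ≡⟨ regroup₁ Q₁ Q₂ Q₃ r₁ r₂ r₃ n b c′ c L ⟩
    Q₂ * (r₁ * r₃ + n * A + n * C) + Q₁ * Q₃ * (r₂ + Q₂ * c) + Q₁₂₃ * L * n
      ≡⟨ cong₂ (λ x y → Q₂ * x + Q₁ * Q₃ * y + Q₁₂₃ * L * n)
               residues-product (trans (+-comm r₂ (Q₂ * c)) (sym n≡₂)) ⟩
    Q₂ * (n * n + A * C) + Q₁ * Q₃ * n + Q₁₂₃ * L * n
      ≡⟨ regroup₂ Q₁ Q₂ Q₃ n b c′ L ⟩
    Q₂ * n * n + Q₁ * Q₃ * n + Q₁₂₃ * (c′ * b + L * n)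
      ≡⟨ cong (λ x → Q₂ * n * n + Q₁ * Q₃ * n + Q₁₂₃ * x) (sym c+Kn≡c′b+Ln) ⟩
    Q₂ * n * n + Q₁ * Q₃ * n + Q₁₂₃ * (c + K * n)
      ≡⟨ regroup₃ Q₁ Q₂ Q₃ n c K ⟩
    n * R + Q₁₂₃ * c ∎)
    where
    regroup₁ : ∀ Q₁ Q₂ Q₃ r₁ r₂ r₃ n b c′ c L →
      Q₂ * r₁ * r₃ + Q₁ * Q₃ * r₂ + n * (Q₂ * (Q₁ * b) + Q₂ * (Q₃ * c′) + Q₁ * Q₂ * Q₃ * L)
        + Q₁ * Q₂ * Q₃ * c
      ≡ Q₂ * (r₁ * r₃ + n * (Q₁ * b) + n * (Q₃ * c′)) + Q₁ * Q₃ * (r₂ + Q₂ * c)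
        + Q₁ * Q₂ * Q₃ * L * n
    regroup₁ = solve-∀
    regroup₂ : ∀ Q₁ Q₂ Q₃ n b c′ L →
      Q₂ * (n * n + (Q₁ * b) * (Q₃ * c′)) + Q₁ * Q₃ * n + Q₁ * Q₂ * Q₃ * L * n
      ≡ Q₂ * n * n + Q₁ * Q₃ * n + Q₁ * Q₂ * Q₃ * (c′ * b + L * n)
    regroup₂ = solve-∀
    regroup₃ : ∀ Q₁ Q₂ Q₃ n c K →
      Q₂ * n * n + Q₁ * Q₃ * n + Q₁ * Q₂ * Q₃ * (c + K * n)
      ≡ n * (Q₂ * n + Q₁ * Q₃ + Q₁ * Q₂ * Q₃ * K) + Q₁ * Q₂ * Q₃ * c
    regroup₃ = solve-∀

-- If n ∣ X + Y with X, Y > 0 then n ≤ X + Y ≤ 2 X Y; so m³ X Y < n³ implies m³ < 2 n².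
cube-from-product : ∀ {n m X Y} → 0 < X → 0 < Y → n ∣ X + Y → m ^ 3 * (X * Y) < n ^ 3 →
  m ^ 3 < 2 * n ^ 2
cube-from-product {n} {m} {X} {Y} X>0 Y>0 n∣X+Y m³XY<n³ =
  *-cancelʳ-< n (m ^ 3) (2 * n ^ 2) (begin-strict
    m ^ 3 * n                ≤⟨ *-monoʳ-≤ (m ^ 3) n≤2XY ⟩
    m ^ 3 * (2 * (X * Y))    ≡⟨ swap (m ^ 3) (X * Y) ⟩
    2 * (m ^ 3 * (X * Y))    <⟨ *-monoʳ-< 2 m³XY<n³ ⟩
    2 * n ^ 3                ≡⟨ cube n ⟩
    2 * n ^ 2 * n            ∎)
  where
  open ≤-Reasoning
  instance
    X≢0 : NonZero X
    X≢0 = >-nonZero X>0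
    Y≢0 : NonZero Y
    Y≢0 = >-nonZero Y>0
  n≤2XY : n ≤ 2 * (X * Y)
  n≤2XY = ≤-trans (∣⇒≤ {{>-nonZero (<-≤-trans X>0 (m≤m+n X Y))}} n∣X+Y)
            (+-mono-≤ (m≤m*n X Y) (≤-trans (m≤n*m Y X) (≤-reflexive (sym (+-identityʳ (X * Y))))))
  swap : ∀ a b → a * (2 * b) ≡ 2 * (a * b)
  swap = solve-∀
  cube : ∀ x → 2 * (x * (x * (x * 1))) ≡ 2 * (x * (x * 1)) * x
  cube = solve-∀

arithmetic-bound : ∀ {n m b c c′}
  (D₁ : ProperDivision n b) (D₂ : ProperDivision n c) (D₃ : ProperDivision n c′) →
  m * ProperDivision.rem D₁ < b → m * ProperDivision.rem D₂ < c → m * ProperDivision.rem D₃ < c′ →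
  Cong n c (c′ * b) → m ^ 3 < 2 * n ^ 2
arithmetic-bound {n} {m} D₁ D₂ D₃ mr₁<b mr₂<c mr₃<c′ c≋c′b =
  cube-from-product {m = m} {Q₂ * r₁ * r₃} {Q₁ * Q₃ * r₂} (*-mono-< (*-mono-< Q₂>0 r₁>0) r₃>0) (*-mono-< (*-mono-< Q₁>0 Q₃>0) r₂>0)
    (residue-relation D₁ D₂ D₃ c≋c′b)
    (begin-strict
      m ^ 3 * (Q₂ * r₁ * r₃ * (Q₁ * Q₃ * r₂))
        ≡⟨ rearrange m r₁ r₂ r₃ Q₁ Q₂ Q₃ ⟩
      m * r₁ * Q₁ * (m * r₂ * Q₂) * (m * r₃ * Q₃)
        <⟨ *-mono-< (*-mono-< (scaled-bound {m = m} D₁ mr₁<b) (scaled-bound {m = m} D₂ mr₂<c))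
                    (scaled-bound {m = m} D₃ mr₃<c′) ⟩
      n * n * n
        ≡⟨ cube n ⟩
      n ^ 3 ∎)
  where
  open ≤-Reasoning
  open ProperDivision D₁ using ()
    renaming (quot to Q₁; quot>0 to Q₁>0; rem to r₁; rem>0 to r₁>0)
  open ProperDivision D₂ using ()
    renaming (quot to Q₂; quot>0 to Q₂>0; rem to r₂; rem>0 to r₂>0)
  open ProperDivision D₃ using ()
    renaming (quot to Q₃; quot>0 to Q₃>0; rem to r₃; rem>0 to r₃>0)
  rearrange : ∀ m r₁ r₂ r₃ Q₁ Q₂ Q₃ →
    m * (m * (m * 1)) * (Q₂ * r₁ * r₃ * (Q₁ * Q₃ * r₂))
    ≡ m * r₁ * Q₁ * (m * r₂ * Q₂) * (m * r₃ * Q₃)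
  rearrange = solve-∀
  cube : ∀ x → x * x * x ≡ x * (x * (x * 1))
  cube = solve-∀

cube-bound : ∀ {n e g h m} → Unit n e →
  PairBound n e g m → PairBound n e h m → PairBound n g h m → m ^ 3 < 2 * n ^ 2
cube-bound {n} {m = m} e-unit eg eh gh =
  arithmetic-bound {m = m} (division eg) (division eh) (division gh) (bound eg) (bound eh) (bound gh)
    (Congruence.σ-relation n e-unit (isσ eg) (isσ eh) (isσ gh))
  where open PairBound

distinct⇒1<n : ∀ {n e g} → e < n → g < n → e ≢ g → 1 < n
distinct⇒1<n {suc (suc _)} _ _ _ = s≤s z<s
distinct⇒1<n {suc zero} z<s z<s e≢g = ⊥-elim (e≢g refl)

proposition6p4 : (n e g h : ℕ) → e < n → g < n → h < n →
    e ≢ g → e ≢ h → g ≢ h →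
    Generates n e → Generates n g →
    (o d : ℕ) → IsOrder n h o → d * o ≡ n →
    (∀ a → IsSigma n e h a → a ≢ d) →
    (∀ a → IsSigma n g h a → a ≢ d) →
    (m : ℕ) → IsMinΔ n (e ∷ g ∷ h ∷ []) m →
    m ^ 3 < 2 * n ^ 2
proposition6p4 zero _ _ _ () _ _ _ _ _ _ _ _ _ _ _ _ _ _ _
proposition6p4 (suc _) _ _ _ _ _ _ _ _ _ _ _ _ _ _ _ _ _ _ (inj₁ (refl , _)) = z<s
proposition6p4 n e g h e<n g<n h<n e≢g _ _ gen-e gen-g o d ord do≡n σe≢d σg≢d m
               (inj₂ (m∈Δ , m≤Δ)) = cube-bound unit-e bound-eg bound-eh bound-gh
  where
  open Pairs e g h
  1<n : 1 < n
  1<n = distinct⇒1<n e<n g<n e≢g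
  unit-e : Unit n e
  unit-e = gen-e 1 1<n
  unit-g : Unit n g
  unit-g = gen-g 1 1<n
  open Sigma n {{>-nonZero (<-trans z<s 1<n)}}
  m∣gaps : Factorizations.DividesLengthGaps n (e ∷ g ∷ h ∷ []) m
  m∣gaps = Factorizations.minΔ∣gaps n (e ∷ g ∷ h ∷ []) m≤Δ m∈Δ
  -- σ_e(g) ∤ n because g ≠ e generates G; σ_e(h), σ_g(h) ∤ n because they differ from d
  bound-eg : PairBound n e g m
  bound-eg = pair-bound 1<n pair-eg gen-e g<n
    (λ b σb → σ∤n-generator e<n g<n e≢g unit-e gen-g σb) m∣gaps
  bound-eh : PairBound n e h m
  bound-eh = pair-bound 1<n pair-eh gen-e h<n
    (λ c σc → σ∤n-order unit-e σc ord do≡n (σe≢d c σc)) m∣gaps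
  bound-gh : PairBound n g h m
  bound-gh = pair-bound 1<n pair-gh gen-g h<n
    (λ c′ σc′ → σ∤n-order unit-g σc′ ord do≡n (σg≢d c′ σc′)) m∣gaps
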